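{- Let $\vdash$ and $\mid\!\sim$ be binary relations on $Form$ with $\vdash\subseteq\mid\!\sim$ such that $\mid\!\sim$ satisfies (A), (Cut), ($\land$L), ($\land$R) and ($\lor$R). Let $F$ be a function assigning a formula $F(\langle\alpha_1,\beta_1\rangle,\dots,\langle\alpha_n,\beta_n\rangle)$ to each finite nonempty sequence of pairs of formulas, and for $\Delta\subseteq Form$ let $I_{\vdash,F}(\Delta)=\{\varphi\mid\exists n\ge1,\ \alpha_1,\dots,\alpha_n\in\Delta,\ \beta_1,\dots,\beta_n\notin\Delta$ with $\varphi\vdash F(\langle\alpha_1,\beta_1\rangle,\dots,\langle\alpha_n,\beta_n\rangle)\}$. Let $I\subseteq Form$ be either a singleton or closed under disjunction, and let $\mathcal S_I=\{\Delta\subseteq Form\mid\Delta$ is $\mid\!\sim$-closed and $\Delta\cap I=\emptyset\}$. Let $\mathcal S\subseteq\mathcal S_I$ be an end-segment of $\mathcal S_I$, i.e. whenever $\Delta_1\in\mathcal S$, $\Delta_2\in\mathcal S_I$ and $\Delta_1\subseteq\Delta_2$, then $\Delta_2\in\mathcal S$. Let $\Phi$ be a maximal element of $\mathcal S$ (w.r.t. $\subseteq$). Then: (1) For every $\Gamma\subseteq Form$: if $\mid\!\sim$ satisfies the rule ($\Gamma\vdash F$) — for all $n\ge1$ and formulas, if $\Gamma\vdash F(\langle\alpha_1,\beta_1\rangle,\dots,\langle\alpha_n,\beta_n\rangle)$ and $\psi_j\land\beta_j\mid\!\sim\varphi$ for all $1\le j\le n$, then $\bigwedge_j(\psi_j\land\alpha_j)\mid\!\sim\varphi$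 — then $\Gamma\cap I_{\vdash,F}(\Phi)=\emptyset$. (2) If $\mid\!\sim$ satisfies the rule ($F$-MP) — for all $n\ge1$ and formulas, if $\psi_j\land\beta_j\mid\!\sim\varphi$ for all $1\le j\le n$ then $\bigwedge_j(\psi_j\land\alpha_j)\land F(\langle\alpha_1,\beta_1\rangle,\dots,\langle\alpha_n,\beta_n\rangle)\mid\!\sim\varphi$ — then $\Phi\cap I_{\vdash,F}(\Phi)=\emptyset$.
   Context: Formulas are built from a countable set $PL$ of propositional letters and the constant $\bot$ using binary connectives $\land,\lor,\to$; $Form$ is the set of formulas; $\top:=\bot\to\bot$. Any relation $\vdash\subseteq Form\times Form$ is extended to sets: $\Gamma\vdash\alpha$ iff $\bigwedge\Gamma_0\vdash\alpha$ for some finite $\Gamma_0\subseteq\Gamma$ ($\bigwedge\emptyset=\top$). $Th_\vdash(\Gamma)=\{\alpha\mid\Gamma\vdash\alpha\}$ and $\Gamma$ is $\vdash$-closed iff $Th_\vdash(\Gamma)\subseteq\Gamma$. A set $I$ is closed under disjunction if $\alpha,\beta\in I$ imply $\alpha\lor\beta\in I$. Rules for a relation $\mid\!\sim$: (A) $\alpha\mid\!\sim\alpha$; (Cut) $\alpha\mid\!\sim\beta$ and $\beta\mid\!\sim\gamma$ imply $\alpha\mid\!\sim\gamma$; ($\land$R) $\chi\mid\!\sim\alpha$ and $\chi\mid\!\sim\beta$ imply $\chi\mid\!\sim\alpha\land\beta$; ($\land$L) $\alpha\land\beta\mid\!\sim\alpha$ and $\alpha\land\beta\mid\!\sim\beta$;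 ($\lor$R) $\alpha\mid\!\sim\alpha\lor\beta$ and $\beta\mid\!\sim\alpha\lor\beta$. -}

module Defs where

open import Data.Nat using (ℕ)
open import Data.Product using (Σ; ∃; _×_; _,_; proj₁; proj₂)
open import Data.Sum using (_⊎_)
open import Data.Empty using (⊥)
open import Data.List using (List; []; _∷_; map)
open import Data.List.NonEmpty using (List⁺; toList) renaming (map to map⁺)
open import Data.List.Relation.Unary.All using (All)
open import Data.List.Relation.Unary.Unique.Propositional using (Unique)
open import Relation.Binary.PropositionalEquality using (_≡_)
open import Relation.Nullary using (¬_)

infixr 30 _∧_
infixr 25 _∨_
infixr 20 _⇒_

data Form : Set where
  var : ℕ → Form
  fal : Form
  _∧_ : Form → Form → Form
  _∨_ : Form → Form → Form
  _⇒_ : Form → Form → Form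

tru : Form
tru = fal ⇒ fal

Rel : Set₁
Rel = Form → Form → Set

FSet : Set₁
FSet = Form → Set

_⊆_ : FSet → FSet → Set
Γ ⊆ Δ = ∀ x → Γ x → Δ x

⋀ : List Form → Form
⋀ [] = tru
⋀ (a ∷ []) = a
⋀ (a ∷ b ∷ as) = a ∧ ⋀ (b ∷ as)

-- Extension of a relation to sets: Γ ⊢ α iff ⋀Γ₀ ⊢ α for some finite Γ₀ ⊆ Γ
-- (Γ₀ given by a duplicate-free enumeration).
_⟨_⟩_ : FSet → Rel → Form → Set
Γ ⟨ R ⟩ α = Σ (List Form) λ Γ₀ → Unique Γ₀ × All Γ Γ₀ × R (⋀ Γ₀) α

Closed : Rel → FSet → Set
Closed R Γ = ∀ α → Γ ⟨ R ⟩ α → Γ α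

ClosedUnderDisj : FSet → Set
ClosedUnderDisj I = ∀ α β → I α → I β → I (α ∨ β)

Singleton : FSet → Set
Singleton I = Σ Form λ χ → I χ × (∀ x → I x → x ≡ χ)

RuleA : Rel → Set
RuleA R = ∀ α → R α α

RuleCut : Rel → Set
RuleCut R = ∀ α β γ → R α β → R β γ → R α γ

Rule∧R : Rel → Set
Rule∧R R = ∀ χ α β → R χ α → R χ β → R χ (α ∧ β)

Rule∧L : Rel → Set
Rule∧L R = ∀ α β → R (α ∧ β) α × R (α ∧ β) β

Rule∨R : Rel → Set
Rule∨R R = ∀ α β → R α (α ∨ β) × R β (α ∨ β)

FFun : Set
FFun = List⁺ (Form × Form) → Form

IF : Rel → FFun → FSet → FSet
IF ⊢ F Δ φ = Σ (List⁺ (Form × Form)) λ ps →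
  All (λ p → Δ (proj₁ p) × ¬ Δ (proj₂ p)) (toList ps) × ⊢ φ (F ps)

ψ : Form × Form × Form → Form
ψ t = proj₁ t
αβ : Form × Form × Form → Form × Form
αβ t = proj₂ t

SI : Rel → FSet → FSet → Set
SI R I Δ = Closed R Δ × (∀ x → Δ x → I x → ⊥)

EndSegment : Rel → FSet → (FSet → Set) → Set₁
EndSegment R I S =
  (∀ Δ → S Δ → SI R I Δ) ×
  (∀ Δ₁ Δ₂ → S Δ₁ → SI R I Δ₂ → Δ₁ ⊆ Δ₂ → S Δ₂)

Maximal : (FSet → Set) → FSet → Set₁
Maximal S Φ = S Φ × (∀ Δ → S Δ → Φ ⊆ Δ → Δ ⊆ Φ)

RuleΓF : Rel → Rel → FFun → FSet → Set
RuleΓF ⊢ R F Γ = ∀ (ts : List⁺ (Form × Form × Form)) φ →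
  Γ ⟨ ⊢ ⟩ F (map⁺ αβ ts) →
  All (λ t → R (ψ t ∧ proj₂ (αβ t)) φ) (toList ts) →
  R (⋀ (map (λ t → ψ t ∧ proj₁ (αβ t)) (toList ts))) φ

RuleFMP : Rel → FFun → Set
RuleFMP R F = ∀ (ts : List⁺ (Form × Form × Form)) φ →
  All (λ t → R (ψ t ∧ proj₂ (αβ t)) φ) (toList ts) →
  R (⋀ (map (λ t → ψ t ∧ proj₁ (αβ t)) (toList ts)) ∧ F (map⁺ αβ ts)) φ

{-# OPTIONS --safe #-}
module Submission where

-- If β ∉ Φ, the set extend Φ β = {x ∣ ψ ∧ β ∣∼ x for some ψ ∈ Φ} is ∣∼-closed and
-- strictly above Φ, so by the end-segment property and maximality it must meet I:
-- some ψ ∈ Φ has ψ ∧ β ∣∼ ι ∈ I. For α_j ∈ Φ and β_j ∉ Φ choose such ψ_j, ι_j and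
-- merge the ι_j into a single ι ∈ I, using that I is a singleton or closed under ∨.
-- The rule now derives ι from ⋀_j (ψ_j ∧ α_j) ∈ Φ (conjoined with F(…) ∈ Φ for F-MP),
-- so ι ∈ Φ ∩ I. Maximality only refutes the absence of ψ, ι, so they are obtained
-- under a double negation, which is harmless since the goal is ⊥.

open import Defs
open import Level using (0ℓ)
open import Data.Product using (_×_; Σ; _,_; proj₁; proj₂)
open import Data.Sum using (_⊎_; inj₁; inj₂)
open import Data.Empty using (⊥)
open import Data.List using ([]; _∷_; map)
open import Data.List.NonEmpty using (List⁺; _∷_; toList) renaming (map to map⁺)
open import Data.List.Relation.Unary.All using (All; []; _∷_; mapM)
import Data.List.Relation.Unary.All as All
open import Data.List.Relation.Unary.All.Properties using () renaming (map⁺ to All-map⁺)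
open import Data.List.Relation.Unary.AllPairs using ([]; _∷_)
open import Relation.Binary.PropositionalEquality using (_≡_; refl; sym; trans; cong)
open import Relation.Nullary using (¬_)
open import Relation.Nullary.Negation using (¬¬-Monad; ¬¬-map)

toList-map⁺ : ∀ {A B : Set} (f : A → B) (xs : List⁺ A) → toList (map⁺ f xs) ≡ map f (toList xs)
toList-map⁺ f (_ ∷ _) = refl

⟨⟩-single : ∀ {Γ : FSet} {Q : Rel} {a b} → Γ a → Q a b → Γ ⟨ Q ⟩ b
⟨⟩-single Γa Qab = (_ ∷ []) , ([] ∷ []) , (Γa ∷ []) , Qab

⋀-closed : ∀ {Γ : FSet} → Γ tru → (∀ {a b} → Γ a → Γ b → Γ (a ∧ b)) →
           ∀ {L} → All Γ L → Γ (⋀ L)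
⋀-closed Γtru Γ∧ []             = Γtru
⋀-closed Γtru Γ∧ (Γa ∷ [])      = Γa
⋀-closed Γtru Γ∧ (Γa ∷ Γb ∷ ΓL) = Γ∧ Γa (⋀-closed Γtru Γ∧ (Γb ∷ ΓL))

closed-intro : ∀ {R : Rel} {Γ : FSet} → Γ tru → (∀ {a b} → Γ a → Γ b → Γ (a ∧ b)) →
               (∀ {a b} → Γ a → R a b → Γ b) → Closed R Γ
closed-intro Γtru Γ∧ Γstep _ (_ , _ , ΓL , R⋀L) = Γstep (⋀-closed Γtru Γ∧ ΓL) R⋀L

Directed : Rel → FSet → Set
Directed R I = ∀ {ι ι'} → I ι → I ι' → Σ Form λ κ → I κ × R ι κ × R ι' κ

singleton-or-∨-closed⇒directed : ∀ {R : Rel} {I : FSet} → RuleA R → Rule∨R R →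
  Singleton I ⊎ ClosedUnderDisj I → Directed R I
singleton-or-∨-closed⇒directed rA r∨R (inj₁ (χ , Iχ , only-χ)) Iι Iι'
  with refl ← only-χ _ Iι | refl ← only-χ _ Iι' = χ , Iχ , rA χ , rA χ
singleton-or-∨-closed⇒directed rA r∨R (inj₂ ∨-closed) Iι Iι' =
  _ , ∨-closed _ _ Iι Iι' , proj₁ (r∨R _ _) , proj₂ (r∨R _ _)

module Consequence {R : Rel} (rA : RuleA R) (rCut : RuleCut R)
                   (r∧L : Rule∧L R) (r∧R : Rule∧R R) where

  cut : ∀ {a b c} → R a b → R b c → R a c
  cut = rCut _ _ _

  ∧-fst : ∀ {a b} → R (a ∧ b) a
  ∧-fst = proj₁ (r∧L _ _)

  ∧-snd : ∀ {a b} → R (a ∧ b) b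
  ∧-snd = proj₂ (r∧L _ _)

  ∧-pair : ∀ {c a b} → R c a → R c b → R c (a ∧ b)
  ∧-pair = r∧R _ _ _

  ∧-map : ∀ {a a' b b'} → R a a' → R b b' → R (a ∧ b) (a' ∧ b')
  ∧-map f g = ∧-pair (cut ∧-fst f) (cut ∧-snd g)

  module _ {Γ : FSet} (closed : Closed R Γ) where

    closed-step : ∀ {a b} → Γ a → R a b → Γ b
    closed-step Γa Rab = closed _ (⟨⟩-single {Q = R} Γa Rab)

    closed-tru : Γ tru
    closed-tru = closed tru ([] , [] , [] , rA tru)

    -- Closedness only speaks about duplicate-free lists, so a and b are
    -- padded to a ∧ a and b ∧ (b ∧ b), which can never coincide.
    closed-∧ : ∀ {a b} → Γ a → Γ b → Γ (a ∧ b)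
    closed-∧ {a} {b} Γa Γb =
      closed (a ∧ b) ((a ∧ a ∷ b ∧ (b ∧ b) ∷ []) , ((λ ()) ∷ []) ∷ [] ∷ []
                     , Γaa ∷ Γbbb ∷ [] , ∧-map ∧-fst ∧-fst)
      where
      Γaa : Γ (a ∧ a)
      Γaa = closed-step Γa (∧-pair (rA a) (rA a))
      Γbbb : Γ (b ∧ (b ∧ b))
      Γbbb = closed-step Γb (∧-pair (rA b) (∧-pair (rA b) (rA b)))

    closed-⋀ : ∀ {L} → All Γ L → Γ (⋀ L)
    closed-⋀ = ⋀-closed closed-tru closed-∧

  extend : FSet → Form → FSet
  extend Φ β x = Σ Form λ ψ → Φ ψ × R (ψ ∧ β) x

  ⊆-extend : ∀ {Φ β} → Φ ⊆ extend Φ β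
  ⊆-extend x Φx = x , Φx , ∧-fst

  module _ {Φ : FSet} (closed : Closed R Φ) {β : Form} where

    extend-∋ : extend Φ β β
    extend-∋ = tru , closed-tru closed , ∧-snd

    extend-closed : Closed R (extend Φ β)
    extend-closed = closed-intro
      (tru , closed-tru closed , ∧-fst)
      (λ { (ψ₁ , Φψ₁ , r₁) (ψ₂ , Φψ₂ , r₂) →
             ψ₁ ∧ ψ₂ , closed-∧ closed Φψ₁ Φψ₂
                     , ∧-pair (cut (∧-map ∧-fst (rA β)) r₁) (cut (∧-map ∧-snd (rA β)) r₂) })
      (λ { (ψ , Φψ , r) s → ψ , Φψ , cut r s })

module MaximalElement {R : Rel} {I : FSet} {S : FSet → Set} {Φ : FSet}
  (rA : RuleA R) (rCut : RuleCut R) (r∧L : Rule∧L R) (r∧R : Rule∧R R)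
  (directed : Directed R I) (end-segment : EndSegment R I S) (maximal : Maximal S Φ) where

  open Consequence rA rCut r∧L r∧R

  Φ∈SI : SI R I Φ
  Φ∈SI = proj₁ end-segment Φ (proj₁ maximal)

  Φ-closed : Closed R Φ
  Φ-closed = proj₁ Φ∈SI

  Φ-avoids-I : ∀ {a ι} → Φ a → R a ι → ¬ I ι
  Φ-avoids-I Φa Raι = proj₂ Φ∈SI _ (closed-step Φ-closed Φa Raι)

  record Blocker (β : Form) : Set where
    field
      context    : Form
      context∈Φ  : Φ context
      target     : Form
      target∈I   : I target
      derivation : R (context ∧ β) target

  ∉⇒blocked : ∀ {β} → ¬ Φ β → ¬ ¬ Blocker β
  ∉⇒blocked {β} Φ∌β unblocked =
    Φ∌β (proj₂ maximal (extend Φ β) extension∈S ⊆-extend β (extend-∋ Φ-closed))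
    where
    extension∈SI : SI R I (extend Φ β)
    extension∈SI = extend-closed Φ-closed
                 , λ { ι (ψ , Φψ , r) Iι → unblocked (record
                       { context = ψ ; context∈Φ = Φψ ; target = ι ; target∈I = Iι ; derivation = r }) }

    extension∈S : S (extend Φ β)
    extension∈S = proj₂ end-segment Φ (extend Φ β) (proj₁ maximal) extension∈SI ⊆-extend

  record Blockers (ps : List⁺ (Form × Form)) : Set where
    field
      triples        : List⁺ (Form × Form × Form)
      pairs≡         : map⁺ αβ triples ≡ ps
      target         : Form
      target∈I       : I target
      derivations    : All (λ t → R (ψ t ∧ proj₂ (αβ t)) target) (toList triples)
      antecedents∈Φ  : All (λ t → Φ (ψ t ∧ proj₁ (αβ t))) (toList triples)

    conjunction∈Φ : Φ (⋀ (map (λ t → ψ t ∧ proj₁ (αβ t)) (toList triples)))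
    conjunction∈Φ = closed-⋀ Φ-closed (All-map⁺ antecedents∈Φ)

  single-blockers : ∀ {α β} → Φ α → Blocker β → Blockers ((α , β) ∷ [])
  single-blockers {α} {β} Φα b = record
    { triples = (context , α , β) ∷ [] ; pairs≡ = refl
    ; target = target ; target∈I = target∈I
    ; derivations = derivation ∷ [] ; antecedents∈Φ = closed-∧ Φ-closed context∈Φ Φα ∷ [] }
    where open Blocker b

  cons-blockers : ∀ {α β ps} → Φ α → Blocker β → Blockers ps → Blockers ((α , β) ∷ toList ps)
  cons-blockers {α} {β} Φα b bs =
    let (κ , Iκ , Rικ , Rι'κ) = directed B.target∈I BS.target∈I in record
    { triples = (B.context , α , β) ∷ toList BS.triples
    ; pairs≡ = cong ((α , β) ∷_) (trans (sym (toList-map⁺ αβ BS.triples)) (cong toList BS.pairs≡))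
    ; target = κ ; target∈I = Iκ
    ; derivations = cut B.derivation Rικ ∷ All.map (λ d → cut d Rι'κ) BS.derivations
    ; antecedents∈Φ = closed-∧ Φ-closed B.context∈Φ Φα ∷ BS.antecedents∈Φ }
    where
    module B = Blocker b
    module BS = Blockers bs

  blockers : ∀ ps → All (λ p → Φ (proj₁ p) × Blocker (proj₂ p)) (toList ps) → Blockers ps
  blockers (_ ∷ [])     ((Φα , b) ∷ [])  = single-blockers Φα b
  blockers (_ ∷ p ∷ ps) ((Φα , b) ∷ hyps) = cons-blockers Φα b (blockers (p ∷ ps) hyps)

  separated⇒blocked : ∀ {ps} → All (λ p → Φ (proj₁ p) × ¬ Φ (proj₂ p)) (toList ps) → ¬ ¬ Blockers ps
  separated⇒blocked {ps} hyps =
    ¬¬-map (blockers ps) (mapM 0ℓ ¬¬-Monad (λ (Φα , Φ∌β) → ¬¬-map (Φα ,_) (∉⇒blocked Φ∌β)) hyps)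

  ΓF⇒Γ-disjoint-IF : ∀ {⊢ F} (Γ : FSet) → RuleΓF ⊢ R F Γ → ∀ φ → Γ φ → IF ⊢ F Φ φ → ⊥
  ΓF⇒Γ-disjoint-IF {⊢} Γ rule φ Γφ (ps , separated , φ⊢F) = separated⇒blocked separated λ where
    bs@record { triples = ts ; pairs≡ = refl } →
      let open Blockers bs in
      Φ-avoids-I conjunction∈Φ (rule ts target (⟨⟩-single {Q = ⊢} Γφ φ⊢F) derivations) target∈I

  FMP⇒Φ-disjoint-IF : ∀ {⊢ F} → (∀ α β → ⊢ α β → R α β) → RuleFMP R F → ∀ φ → Φ φ → IF ⊢ F Φ φ → ⊥
  FMP⇒Φ-disjoint-IF ⊢⊆R rule φ Φφ (ps , separated , φ⊢F) = separated⇒blocked separated λ where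
    bs@record { triples = ts ; pairs≡ = refl } →
      let open Blockers bs
          F∈Φ = closed-step Φ-closed Φφ (⊢⊆R _ _ φ⊢F) in
      Φ-avoids-I (closed-∧ Φ-closed conjunction∈Φ F∈Φ) (rule ts target derivations) target∈I

lemma14 : (⊢ R : Rel) (F : FFun) (I : FSet) (S : FSet → Set) (Φ : FSet) →
    (∀ α β → ⊢ α β → R α β) →
    RuleA R → RuleCut R → Rule∧L R → Rule∧R R → Rule∨R R →
    (Singleton I ⊎ ClosedUnderDisj I) →
    EndSegment R I S →
    Maximal S Φ →
    (∀ (Γ : FSet) → RuleΓF ⊢ R F Γ → ∀ φ → Γ φ → IF ⊢ F Φ φ → ⊥)
    × (RuleFMP R F → ∀ φ → Φ φ → IF ⊢ F Φ φ → ⊥)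
lemma14 ⊢ R F I S Φ ⊢⊆R rA rCut r∧L r∧R r∨R I-shape end-segment maximal =
  ΓF⇒Γ-disjoint-IF {⊢} {F} , FMP⇒Φ-disjoint-IF {⊢} {F} ⊢⊆R
  where
  open MaximalElement rA rCut r∧L r∧R
         (singleton-or-∨-closed⇒directed rA r∨R I-shape) end-segment maximal
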